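{- Consider the infinite Jaco graph $J_\infty(1)$, with the convention $d^+(v_0)=0$. For every $i\in\mathbb N$, $$d^+\big(v_{i+d^+(v_i)}\big)=i=d^+\big(v_{i+d^+(v_{i-1})}\big).$$
   Context: $J_\infty(1)$ is the directed graph with vertex set $\{v_i:i\in\mathbb N\}$, $\mathbb N=\{1,2,\dots\}$, in which every arc has the form $(v_i,v_j)$ with $i<j$, and for $i<j$, $(v_i,v_j)$ is an arc iff $2i-d^-(v_i)\ge j$, where $d^-(v_i)$ is the in-degree of $v_i$ (determined recursively). $d^+(v_n)$ denotes the out-degree of $v_n$. -}

module Defs where

open import Data.Nat using (ℕ; zero; suc; _+_; _*_; _∸_; _≤_; _<_; _≤?_; _<?_)
open import Data.List using (List; length; filter; upTo)
open import Data.Product using (_×_)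
open import Relation.Nullary using (Dec; yes; no)
open import Relation.Nullary.Decidable using (_×-dec_)

-- Vertices of J_∞(1) are v_i for i ≥ 1 (encoded by i : ℕ; index 0 is not a vertex).
-- inDegTable n k is the in-degree d⁻(v_k), correct for 1 ≤ k ≤ n.
-- d⁻(v_{n+1}) = #{ i : 1 ≤ i < n+1 , 2i - d⁻(v_i) ≥ n+1 }.
inDegTable : ℕ → ℕ → ℕ
inDegTable zero k = 0
inDegTable (suc n) k with k ≤? n
... | yes _ = inDegTable n k
... | no _ = length (filter (λ i → (1 ≤? i) ×-dec (suc n ≤? 2 * i ∸ inDegTable n i)) (upTo (suc n)))

inDeg : ℕ → ℕ
inDeg j = inDegTable j j

Arc : ℕ → ℕ → Set
Arc i j = (1 ≤ i) × (i < j) × (j ≤ 2 * i ∸ inDeg i)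

arc? : ∀ i j → Dec (Arc i j)
arc? i j = (1 ≤? i) ×-dec ((i <? j) ×-dec (j ≤? 2 * i ∸ inDeg i))

-- out-degree d⁺(v_i): number of j with (v_i , v_j) an arc; every such j satisfies j ≤ 2i,
-- so counting over j < 2i+1 counts all of them.  outDeg 0 = 0 (the convention d⁺(v_0) = 0).
outDeg : ℕ → ℕ
outDeg i = length (filter (λ j → arc? i j) (upTo (suc (2 * i))))

-- Write reach i = 2i − d⁻(v_i) for the head of the last arc out of v_i, so that d⁺(v_i) = i − d⁻(v_i)
-- and i + d⁺(v_i) = reach i.  By induction on n, reach is strictly increasing and d⁺(v_n) is the
-- threshold of n, the least m with n ≤ reach m: the in-neighbours of v_{n+1} are then exactly
-- v_m, …, v_n for the threshold m of n+1, so d⁻(v_{n+1}) = n + 1 − m and d⁺(v_{n+1}) = m.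
-- The theorem follows because i is the threshold of both reach i and reach (i − 1) + 1.
module Submission where

open import Defs
open import Data.Nat using (ℕ; zero; suc; _+_; _*_; _∸_; _≤_; _<_; _≤?_; _<?_; z≤n; s≤s)
open import Data.Nat.Properties
open import Data.List using ([]; _∷_; _++_; length; filter; upTo)
open import Data.List.Properties
  using (upTo-∷ʳ; filter-++; length-++; filter-accept; filter-reject; length-filter; length-upTo)
open import Data.Product using (_×_; _,_; proj₁; proj₂; Σ-syntax)
open import Data.Sum using (inj₁; inj₂)
open import Function using (_∘′_)
open import Function.Bundles using (_⇔_; mk⇔; Equivalence)
open import Relation.Nullary using (¬_; yes; no; contradiction)
open import Relation.Nullary.Decidable using (_×-dec_)
open import Relation.Unary using (Decidable)
open import Relation.Binary.PropositionalEquality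

count : {P : ℕ → Set} → Decidable P → ℕ → ℕ
count P? n = length (filter P? (upTo n))

module _ {P : ℕ → Set} (P? : Decidable P) where

  count-suc : ∀ n → count P? (suc n) ≡ count P? n + length (filter P? (n ∷ []))
  count-suc n = begin
      length (filter P? (upTo (suc n)))
    ≡⟨ cong (λ xs → length (filter P? xs)) (sym (upTo-∷ʳ n)) ⟩
      length (filter P? (upTo n ++ (n ∷ [])))
    ≡⟨ cong length (filter-++ P? (upTo n) (n ∷ [])) ⟩
      length (filter P? (upTo n) ++ filter P? (n ∷ []))
    ≡⟨ length-++ (filter P? (upTo n)) ⟩
      count P? n + length (filter P? (n ∷ []))
    ∎
    where open ≡-Reasoning

  count-suc-accept : ∀ {n} → P n → count P? (suc n) ≡ suc (count P? n)
  count-suc-accept {n} Pn =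
    trans (count-suc n) (trans (cong (λ xs → count P? n + length xs) (filter-accept P? Pn)) (+-comm _ 1))

  count-suc-reject : ∀ {n} → ¬ P n → count P? (suc n) ≡ count P? n
  count-suc-reject {n} ¬Pn =
    trans (count-suc n) (trans (cong (λ xs → count P? n + length xs) (filter-reject P? ¬Pn)) (+-identityʳ _))

  count-upward-closed : ∀ {a} N → (∀ {i} → i < N → P i ⇔ a ≤ i) → count P? N ≡ N ∸ a
  count-upward-closed {a} zero _ = sym (0∸n≡0 a)
  count-upward-closed {a} (suc N) P⇔ with a ≤? N
  ... | yes a≤N = begin
      count P? (suc N)  ≡⟨ count-suc-accept (Equivalence.from (P⇔ ≤-refl) a≤N) ⟩
      suc (count P? N)  ≡⟨ cong suc (count-upward-closed N (λ i<N → P⇔ (m<n⇒m<1+n i<N))) ⟩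
      suc (N ∸ a)       ≡⟨ sym (+-∸-assoc 1 a≤N) ⟩
      suc N ∸ a         ∎
    where open ≡-Reasoning
  ... | no a≰N = begin
      count P? (suc N)  ≡⟨ count-suc-reject (λ PN → a≰N (Equivalence.to (P⇔ ≤-refl) PN)) ⟩
      count P? N        ≡⟨ count-upward-closed N (λ i<N → P⇔ (m<n⇒m<1+n i<N)) ⟩
      N ∸ a             ≡⟨ m≤n⇒m∸n≡0 (<⇒≤ (≰⇒> a≰N)) ⟩
      0                 ≡⟨ sym (m≤n⇒m∸n≡0 (≰⇒> a≰N)) ⟩
      suc N ∸ a         ∎
    where open ≡-Reasoning

  count-rejected-tail : ∀ {M} N → M ≤ N → (∀ {i} → M ≤ i → i < N → ¬ P i) → count P? N ≡ count P? M
  count-rejected-tail zero z≤n _ = refl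
  count-rejected-tail (suc N) M≤1+N ¬P with m≤n⇒m<n∨m≡n M≤1+N
  ... | inj₂ refl = refl
  ... | inj₁ (s≤s M≤N) =
    trans (count-suc-reject (¬P M≤N ≤-refl)) (count-rejected-tail N M≤N (λ M≤i i<N → ¬P M≤i (m<n⇒m<1+n i<N)))

module StrictlyIncreasingBelow (f : ℕ → ℕ) (n : ℕ) (f-step : ∀ i → i < n → f i < f (suc i)) where

  mono-≤ : ∀ {a b} → a ≤ b → b ≤ n → f a ≤ f b
  mono-≤ {b = zero} z≤n _ = ≤-refl
  mono-≤ {b = suc b} a≤1+b 1+b≤n with m≤n⇒m<n∨m≡n a≤1+b
  ... | inj₁ (s≤s a≤b) = ≤-trans (mono-≤ a≤b (<⇒≤ 1+b≤n)) (<⇒≤ (f-step b 1+b≤n))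
  ... | inj₂ refl = ≤-refl

  cancel-< : ∀ {a b} → a ≤ n → f a < f b → a < b
  cancel-< {a} {b} a≤n fa<fb with a <? b
  ... | yes a<b = a<b
  ... | no a≮b = contradiction (mono-≤ (≮⇒≥ a≮b) a≤n) (<⇒≱ fa<fb)

m∸1<n⇒m≤n : ∀ {m n} → 1 ≤ m → m ∸ 1 < n → m ≤ n
m∸1<n⇒m≤n {suc m} _ m<n = m<n

inDegTable-step : ∀ {n k} → k ≤ n → inDegTable (suc n) k ≡ inDegTable n k
inDegTable-step {n} {k} k≤n with k ≤? n
... | yes _ = refl
... | no k≰n = contradiction k≤n k≰n

inDegTable-stable : ∀ {n k} → k ≤ n → inDegTable n k ≡ inDeg k
inDegTable-stable {zero} z≤n = refl
inDegTable-stable {suc n} k≤1+n with m≤n⇒m<n∨m≡n k≤1+n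
... | inj₁ (s≤s k≤n) = trans (inDegTable-step k≤n) (inDegTable-stable k≤n)
... | inj₂ refl = refl

inNeighbourOfSuc? : (n : ℕ) → Decidable (λ i → 1 ≤ i × suc n ≤ 2 * i ∸ inDegTable n i)
inNeighbourOfSuc? n i = (1 ≤? i) ×-dec (suc n ≤? 2 * i ∸ inDegTable n i)

inDeg-suc : ∀ n → inDeg (suc n) ≡ count (inNeighbourOfSuc? n) (suc n)
inDeg-suc n with suc n ≤? n
... | yes 1+n≤n = contradiction 1+n≤n (<-irrefl refl)
... | no _ = refl

inDeg≤ : ∀ k → inDeg k ≤ k
inDeg≤ zero = z≤n
inDeg≤ (suc n) = begin
  inDeg (suc n)                        ≡⟨ inDeg-suc n ⟩
  count (inNeighbourOfSuc? n) (suc n)  ≤⟨ length-filter (inNeighbourOfSuc? n) (upTo (suc n)) ⟩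
  length (upTo (suc n))                ≡⟨ length-upTo (suc n) ⟩
  suc n                                ∎
  where open ≤-Reasoning

reach : ℕ → ℕ
reach i = 2 * i ∸ inDeg i

reach≡ : ∀ i → reach i ≡ i + (i ∸ inDeg i)
reach≡ i = trans (cong (λ k → i + k ∸ inDeg i) (+-identityʳ i)) (+-∸-assoc i (inDeg≤ i))

n≤reach : ∀ n → n ≤ reach n
n≤reach n = subst (n ≤_) (sym (reach≡ n)) (m≤m+n n _)

arc⇔ : ∀ {i j} → j ≤ reach i → Arc i j ⇔ suc i ≤ j
arc⇔ {zero} z≤n = mk⇔ (λ { (() , _) }) (λ ())
arc⇔ {suc i} j≤reach = mk⇔ (λ (_ , i<j , _) → i<j) (λ i<j → s≤s z≤n , i<j , j≤reach)

outDeg≡ : ∀ i → outDeg i ≡ i ∸ inDeg i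
outDeg≡ i = begin
    outDeg i
  ≡⟨ count-rejected-tail (arc? i) (suc (2 * i)) (s≤s (m∸n≤m (2 * i) (inDeg i)))
       (λ reach<j _ (_ , _ , j≤reach) → <⇒≱ reach<j j≤reach) ⟩
    count (arc? i) (suc (reach i))
  ≡⟨ count-upward-closed (arc? i) (suc (reach i)) (λ j<1+reach → arc⇔ (≤-pred j<1+reach)) ⟩
    reach i ∸ i
  ≡⟨ cong (_∸ i) (reach≡ i) ⟩
    i + (i ∸ inDeg i) ∸ i
  ≡⟨ m+n∸m≡n i _ ⟩
    i ∸ inDeg i
  ∎
  where open ≡-Reasoning

reach≡+outDeg : ∀ i → reach i ≡ i + outDeg i
reach≡+outDeg i = trans (reach≡ i) (cong (i +_) (sym (outDeg≡ i)))

-- Once reach is known to be increasing, m is the least vertex with n ≤ reach m.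
Threshold : ℕ → ℕ → Set
Threshold n m = 1 ≤ m × reach (m ∸ 1) < n × n ≤ reach m

threshold-≤ : ∀ {n m} → Threshold n m → m ≤ n
threshold-≤ {m = zero} (() , _)
threshold-≤ {m = suc m} (_ , reach-m<n , _) = ≤-<-trans (n≤reach m) reach-m<n

threshold-suc : ∀ {n m} → (∀ i → i < n → reach i < reach (suc i)) → n < reach n →
  Threshold n m → Σ[ m′ ∈ ℕ ] Threshold (suc n) m′ × m ≤ m′
threshold-suc {n} {m} increasing n<reach-n thr@(1≤m , below , n≤reach-m) with suc n ≤? reach m
... | yes 1+n≤reach-m = m , (1≤m , m<n⇒m<1+n below , 1+n≤reach-m) , ≤-refl
... | no 1+n≰reach-m =
  suc m , (s≤s z≤n , s≤s (≤-reflexive reach-m≡n) , subst (_< reach (suc m)) reach-m≡n (increasing m m<n)) , n≤1+n m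
  where
  reach-m≡n : reach m ≡ n
  reach-m≡n = ≤-antisym (≤-pred (≰⇒> 1+n≰reach-m)) n≤reach-m
  m<n : m < n
  m<n = ≤∧≢⇒< (threshold-≤ thr) (λ { refl → <-irrefl (sym reach-m≡n) n<reach-n })

inDeg-suc-threshold : ∀ {n m} → (∀ i → i < n → reach i < reach (suc i)) →
  Threshold (suc n) m → inDeg (suc n) ≡ suc n ∸ m
inDeg-suc-threshold {n} {m} increasing thr@(1≤m , below , above) =
  trans (inDeg-suc n) (count-upward-closed (inNeighbourOfSuc? n) (suc n) inNeighbour⇔)
  where
  open StrictlyIncreasingBelow reach n increasing
  inNeighbour⇔ : ∀ {i} → i < suc n → (1 ≤ i × suc n ≤ 2 * i ∸ inDegTable n i) ⇔ m ≤ i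
  inNeighbour⇔ {i} (s≤s i≤n) rewrite inDegTable-stable i≤n = mk⇔
    (λ (_ , 1+n≤reach-i) → m∸1<n⇒m≤n 1≤m (cancel-< (∸-monoˡ-≤ 1 (threshold-≤ thr)) (<-≤-trans below 1+n≤reach-i)))
    (λ m≤i → ≤-trans 1≤m m≤i , ≤-trans above (mono-≤ m≤i i≤n))

outDeg-suc-threshold : ∀ {n m} → (∀ i → i < n → reach i < reach (suc i)) →
  Threshold (suc n) m → outDeg (suc n) ≡ m
outDeg-suc-threshold {n} {m} increasing thr = begin
  outDeg (suc n)         ≡⟨ outDeg≡ (suc n) ⟩
  suc n ∸ inDeg (suc n)  ≡⟨ cong (suc n ∸_) (inDeg-suc-threshold increasing thr) ⟩
  suc n ∸ (suc n ∸ m)    ≡⟨ m∸[m∸n]≡n (threshold-≤ thr) ⟩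
  m                      ∎
  where open ≡-Reasoning

record Regular (n : ℕ) : Set where
  field
    reach-increasing : ∀ i → i < n → reach i < reach (suc i)
    outDeg-threshold : Threshold n (outDeg n)

regular-suc : ∀ {n} → Regular n → Regular (suc n)
regular-suc {n} reg = record
  { reach-increasing = increasing
  ; outDeg-threshold = subst (Threshold (suc n)) (sym outDeg≡m) m-threshold
  }
  where
  open Regular reg
  n<reach-n : n < reach n
  n<reach-n = subst (n <_) (sym (reach≡+outDeg n)) (m<m+n n (proj₁ outDeg-threshold))
  next : Σ[ m′ ∈ ℕ ] Threshold (suc n) m′ × outDeg n ≤ m′
  next = threshold-suc reach-increasing n<reach-n outDeg-threshold
  m : ℕ
  m = proj₁ next
  m-threshold : Threshold (suc n) m
  m-threshold = proj₁ (proj₂ next)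
  outDeg≤m : outDeg n ≤ m
  outDeg≤m = proj₂ (proj₂ next)
  outDeg≡m : outDeg (suc n) ≡ m
  outDeg≡m = outDeg-suc-threshold reach-increasing m-threshold
  increasing : ∀ i → i < suc n → reach i < reach (suc i)
  increasing i (s≤s i≤n) with m≤n⇒m<n∨m≡n i≤n
  ... | inj₁ i<n = reach-increasing i i<n
  ... | inj₂ refl = begin-strict
    reach n                 ≡⟨ reach≡+outDeg n ⟩
    n + outDeg n            ≤⟨ +-monoʳ-≤ n outDeg≤m ⟩
    n + m                   <⟨ n<1+n (n + m) ⟩
    suc n + m               ≡⟨ cong (suc n +_) outDeg≡m ⟨
    suc n + outDeg (suc n)  ≡⟨ reach≡+outDeg (suc n) ⟨
    reach (suc n)           ∎
    where open ≤-Reasoning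

regular : ∀ n → Regular (suc n)
regular zero = record
  { reach-increasing = λ { zero _ → s≤s z≤n ; (suc i) (s≤s ()) }
  ; outDeg-threshold = s≤s z≤n , s≤s z≤n , s≤s z≤n
  }
regular (suc n) = regular-suc (regular n)

reach-step : ∀ i → reach i < reach (suc i)
reach-step i = Regular.reach-increasing (regular i) i ≤-refl

reach-cancel-< : ∀ {a b} → reach a < reach b → a < b
reach-cancel-< {a} = StrictlyIncreasingBelow.cancel-< reach a (λ i _ → reach-step i) ≤-refl

threshold-unique : ∀ {n p q} → Threshold n p → Threshold n q → p ≡ q
threshold-unique p-thr q-thr = ≤-antisym (threshold-minimal p-thr q-thr) (threshold-minimal q-thr p-thr)
  where
  threshold-minimal : ∀ {n p q} → Threshold n p → Threshold n q → p ≤ q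
  threshold-minimal (1≤p , below , _) (_ , _ , above) = m∸1<n⇒m≤n 1≤p (reach-cancel-< (<-≤-trans below above))

outDeg-threshold : ∀ {n} → 1 ≤ n → Threshold n (outDeg n)
outDeg-threshold {suc n} _ = Regular.outDeg-threshold (regular n)

outDeg-at-threshold : ∀ {n m} → Threshold n m → outDeg n ≡ m
outDeg-at-threshold thr@(_ , below , _) = threshold-unique (outDeg-threshold (≤-trans (s≤s z≤n) below)) thr

lemma3p6 : (i : ℕ) → 1 ≤ i →
    (outDeg (i + outDeg i) ≡ i) × (outDeg (i + outDeg (i ∸ 1)) ≡ i)
lemma3p6 (suc j) _ =
  trans (cong outDeg (sym (reach≡+outDeg (suc j)))) (outDeg-at-threshold (s≤s z≤n , reach-step j , ≤-refl)) ,
  trans (cong (outDeg ∘′ suc) (sym (reach≡+outDeg j))) (outDeg-at-threshold (s≤s z≤n , ≤-refl , reach-step j))
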